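{- Let $\phi$ be a positive $\Lambda$-formula and let $(C_\phi,x_\phi)$ be a weakly simulation-initial (wsi) model for $\phi$. Then $(C_\phi,x_\phi)$ is a materialization of $\phi$, i.e. for every positive $\Lambda$-formula $\psi$ we have $x_\phi\models_{C_\phi}\psi$ if and only if $\phi\sqsubseteq\psi$.
   Context: Fix an endofunctor $T$ on the category of sets that is non-trivial ($TX=\emptyset$ implies $X=\emptyset$) and preserves subsets ($X\subseteq Y$ implies $TX\subseteq TY$, $T$ of an inclusion being the inclusion). A similarity type $\Lambda$ is a set of modal operators $\heartsuit$ (treated as unary; atomic propositions are nullary operators), each interpreted by a monotone predicate lifting: a family of maps $[\![\heartsuit]\!]_X:\mathcal P(X)\to\mathcal P(TX)$, monotone w.r.t. inclusion and natural, i.e. $[\![\heartsuit]\!]_X(f^{ -1}[A])=(Tf)^{ -1}[[\![\heartsuit]\!]_Y(A)]$ for all maps $f:X\to Y$ and $A\subseteq Y$. Write $t\models\heartsuit A$ for $t\in[\![\heartsuit]\!]_X(A)$. A model is a $T$-coalgebra $C=(X,\xi)$ with $\xi:X\to TX$; a pointed model is $(C,x)$ with $x\in X$. Positive $\Lambda$-formulas are given by $\phi::=\top\mid\bot\mid\phi\wedge\phi\mid\phi\vee\phi\mid\heartsuit\phi$ ($\heartsuit\in\Lambda$). Satisfaction $x\models_C\phi$ has the usual Boolean clauses and $x\models_C\heartsuit\phi$ iff $\xi(x)\models\heartsuit[\![\phi]\!]_C$, where $[\![\phi]\!]_C=\{x\in X: x\models_C\phi\}$. Subsumption: $\phi\sqsubseteq\psi$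 iff $[\![\phi]\!]_C\subseteq[\![\psi]\!]_C$ for all coalgebras $C$. For coalgebras $C=(X,\xi)$, $D=(Y,\zeta)$, a relation $S\subseteq X\times Y$ is a $\Lambda$-simulation of $C$ by $D$ if $xSy$ and $\xi(x)\models\heartsuit A$ imply $\zeta(y)\models\heartsuit S[A]$ for all $\heartsuit\in\Lambda$, $A\subseteq X$, where $S[A]=\{y:\exists x\in A.\ xSy\}$; $(D,y)$ $\Lambda$-simulates $(C,x)$ if $xSy$ for some $\Lambda$-simulation $S$ of $C$ by $D$. A pointed model $(C_\phi,x_\phi)$ is weakly simulation-initial (wsi) for $\phi$ if for every pointed model $(D,y)$: $y\models_D\phi$ iff $(D,y)$ $\Lambda$-simulates $(C_\phi,x_\phi)$. -}

module Defs where

open import Level using (0ℓ)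
open import Data.Empty using (⊥)
open import Data.Unit using (⊤)
open import Data.Product using (Σ; _×_; ∃; ∃-syntax; _,_)
open import Data.Sum using (_⊎_)
open import Function using (_∘_; id)
open import Function.Bundles using (_⇔_)
open import Relation.Binary.PropositionalEquality using (_≡_)
open import Relation.Unary using (Pred; _⊆_)

record SetFunctor : Set₁ where
  field
    T       : Set → Set
    fmap    : {X Y : Set} → (X → Y) → T X → T Y
    fmap-id : {X : Set} (t : T X) → fmap id t ≡ t
    fmap-∘  : {X Y Z : Set} (g : Y → Z) (f : X → Y) (t : T X) →
              fmap (g ∘ f) t ≡ fmap g (fmap f t)
    nontrivial : {X : Set} → (T X → ⊥) → (X → ⊥)

_≐_ : {X : Set} → Pred X 0ℓ → Pred X 0ℓ → Set
A ≐ B = (A ⊆ B) × (B ⊆ A)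

record MonLifting (F : SetFunctor) : Set₁ where
  open SetFunctor F
  field
    lift     : {X : Set} → Pred X 0ℓ → Pred (T X) 0ℓ
    monotone : {X : Set} {A B : Pred X 0ℓ} → A ⊆ B → lift A ⊆ lift B
    natural  : {X Y : Set} (f : X → Y) (A : Pred Y 0ℓ) →
               lift (A ∘ f) ≐ (lift A ∘ fmap f)

data Form (Λ : Set) : Set where
  ⊤'  : Form Λ
  ⊥'  : Form Λ
  _∧'_ : Form Λ → Form Λ → Form Λ
  _∨'_ : Form Λ → Form Λ → Form Λ
  ♡   : Λ → Form Λ → Form Λ

module Logic (F : SetFunctor) (Λ : Set) (⟦_⟧ : Λ → MonLifting F) where
  open SetFunctor F

  _⊨⟨_⟩_ : {X : Set} → T X → Λ → Pred X 0ℓ → Set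
  t ⊨⟨ h ⟩ A = MonLifting.lift ⟦ h ⟧ A t

  record Coalg : Set₁ where
    constructor coalg
    field
      Carrier : Set
      ξ       : Carrier → T Carrier
  open Coalg public

  Sat : (C : Coalg) → Form Λ → Pred (Carrier C) 0ℓ
  Sat C ⊤'        x = ⊤
  Sat C ⊥'        x = ⊥
  Sat C (φ ∧' ψ)  x = Sat C φ x × Sat C ψ x
  Sat C (φ ∨' ψ)  x = Sat C φ x ⊎ Sat C ψ x
  Sat C (♡ h φ)   x = ξ C x ⊨⟨ h ⟩ Sat C φ

  _⊑_ : Form Λ → Form Λ → Set₁
  φ ⊑ ψ = (C : Coalg) → Sat C φ ⊆ Sat C ψ

  image : {X Y : Set} → (X → Y → Set) → Pred X 0ℓ → Pred Y 0ℓ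
  image S A y = ∃[ x ] (A x × S x y)

  IsSimulation : (C D : Coalg) → (Carrier C → Carrier D → Set) → Set₁
  IsSimulation C D S =
    (x : Carrier C) (y : Carrier D) → S x y →
    (h : Λ) (A : Pred (Carrier C) 0ℓ) →
    ξ C x ⊨⟨ h ⟩ A → ξ D y ⊨⟨ h ⟩ image S A

  Simulates : (D : Coalg) → Carrier D → (C : Coalg) → Carrier C → Set₁
  Simulates D y C x =
    Σ (Carrier C → Carrier D → Set) λ S → IsSimulation C D S × S x y

  WSI : Form Λ → (C : Coalg) → Carrier C → Set₁
  WSI φ C x = (D : Coalg) (y : Carrier D) → Sat D φ y ⇔ Simulates D y C x

  Materialization : Form Λ → (C : Coalg) → Carrier C → Set₁
  Materialization φ C x = (ψ : Form Λ) → Sat C ψ x ⇔ φ ⊑ ψ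

module Submission where

-- Two general facts about Λ-simulations carry the argument.
--   * Positive formulas are preserved along simulations: if S simulates C
--     by D and x S y, then every positive formula true at x is true at y.
--     This is an induction on the formula; the modal case uses that S maps
--     the truth set of ψ in C into the truth set of ψ in D, together with
--     monotonicity of the predicate lifting.
--   * Every pointed model simulates itself, via the identity relation.  If x ⊨ ψ and y ⊨_D φ, then
-- (D , y) simulates (C , x) by initiality, so y ⊨_D ψ by preservation;
-- hence φ ⊑ ψ.  Conversely, (C , x) simulates itself, so x ⊨_C φ by
-- initiality, and φ ⊑ ψ gives x ⊨_C ψ.

open import Defs
open import Data.Product using (_,_)
open import Data.Sum using (inj₁; inj₂)
open import Data.Unit using (tt)
open import Function.Bundles using (mk⇔; Equivalence)
open import Relation.Binary.PropositionalEquality using (_≡_; refl)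
open import Relation.Unary using (_⊆_)

module Simulations (F : SetFunctor) (Λ : Set) (⟦_⟧ : Λ → MonLifting F) where
  open Logic F Λ ⟦_⟧

  simulation-preserves : (C D : Coalg) (S : Carrier C → Carrier D → Set) →
                         IsSimulation C D S → (ψ : Form Λ) →
                         image S (Sat C ψ) ⊆ Sat D ψ
  simulation-preserves C D S sim ⊤'       _                 = tt
  simulation-preserves C D S sim ⊥'       (_ , () , _)
  simulation-preserves C D S sim (ψ ∧' χ) (x , (p , q) , s) =
    simulation-preserves C D S sim ψ (x , p , s) ,
    simulation-preserves C D S sim χ (x , q , s)
  simulation-preserves C D S sim (ψ ∨' χ) (x , inj₁ p , s)  =
    inj₁ (simulation-preserves C D S sim ψ (x , p , s))
  simulation-preserves C D S sim (ψ ∨' χ) (x , inj₂ q , s)  =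
    inj₂ (simulation-preserves C D S sim χ (x , q , s))
  simulation-preserves C D S sim (♡ h ψ)  (x , p , s)       =
    MonLifting.monotone ⟦ h ⟧ (simulation-preserves C D S sim ψ)
      (sim x _ s h (Sat C ψ) p)

  simulates-preserves : (C : Coalg) (x : Carrier C) (D : Coalg) (y : Carrier D) →
                        Simulates D y C x → (ψ : Form Λ) → Sat C ψ x → Sat D ψ y
  simulates-preserves C x D y (S , sim , s) ψ p =
    simulation-preserves C D S sim ψ (x , p , s)

  -- The identity relation is a simulation of C by itself, since A ⊆ image _≡_ A.
  identity-simulation : (C : Coalg) → IsSimulation C C _≡_
  identity-simulation C x .x refl h A =
    MonLifting.monotone ⟦ h ⟧ (λ {z} a → z , a , refl)

  simulates-refl : (C : Coalg) (x : Carrier C) → Simulates C x C x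
  simulates-refl C x = _≡_ , identity-simulation C , refl

  wsi⇒materialization : (φ : Form Λ) (C : Coalg) (x : Carrier C) →
                        WSI φ C x → Materialization φ C x
  wsi⇒materialization φ C x wsi ψ = mk⇔ entails satisfies
    where
    entails : Sat C ψ x → φ ⊑ ψ
    entails p D {y} q =
      simulates-preserves C x D y (Equivalence.to (wsi D y) q) ψ p
    satisfies : φ ⊑ ψ → Sat C ψ x
    satisfies φ⊑ψ = φ⊑ψ C (Equivalence.from (wsi C x) (simulates-refl C x))

lemma4p4 : (F : SetFunctor) (Λ : Set) (⟦_⟧ : Λ → MonLifting F)
    (φ : Form Λ) (C : Logic.Coalg F Λ ⟦_⟧) (x : Logic.Coalg.Carrier C) →
    Logic.WSI F Λ ⟦_⟧ φ C x → Logic.Materialization F Λ ⟦_⟧ φ C x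
lemma4p4 F Λ ⟦_⟧ = Simulations.wsi⇒materialization F Λ ⟦_⟧
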